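{- Let $D$ be an FDAG with vertices $v_0,\dots,v_n$ numbered by its canonical ordering $\psi$. Let $D'$ be obtained from $D$ by one application of the branching rule, the elongation rule or the widening rule. Then $D'$ is an FDAG, and its canonical ordering is $\psi$ (extended by $\psi(v_{n+1})=n+1$ when a new vertex $v_{n+1}$ is added).
   Context: Trees are finite unordered rooted trees. In a directed multigraph, $\mathrm{child}(v)$ is the multiset of heads of arcs leaving $v$ (with multiplicity); $h(v)=0$ if $v$ has no children, else $1+\max_{u\in\mathrm{child}(v)}h(u)$. An irredundant forest is a finite set of trees none of which is isomorphic to a subtree (vertex plus all descendants) of another. The DAG reduction $\mathcal{R}(F)$ has one vertex per isomorphism class of subtrees occurring in $F$, with, from the class of $T[v]$ to a class $c'$, as many arcs as $v$ has children $u$ with $T[u]\in c'$. An FDAG is a directed acyclic multigraph of the form $\mathcal{R}(F)$, $F$ an irredundant forest; equivalently a finite connected directed acyclic multigraph whose distinct vertices have distinct multisets of children. $<_{\mathrm{lex}}$ is the lexicographical order on words over a totally ordered alphabet (a proper prefix is smaller; otherwise compare at the first differing letter); a word $a_0\cdots a_m$ is decreasing if $a_i\ge a_{i+1}$ for all $i$. $SC(w)$ removes the last letter of a nonempty word $w$, $SC(\epsilon)=\epsilon$. For a bijection $\psi:V(D)\to\{0,\dots,\#D-1\}$, $\mathrm{child}_\psi(v)$ lists $\psi(w)$, $w\in\mathrm{child}(v)$ with multiplicity, in non-increasing order. The canonical ordering of an FDAG is the unique such bijection with $\psi(u)>\psi(v)$ whenever there is an arc $u\to v$, $h(u)>h(v)\Rightarrow\psi(u)>\psi(v)$,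 and ($h(u)=h(v)$ and $\mathrm{child}_\psi(u)>_{\mathrm{lex}}\mathrm{child}_\psi(v))\Rightarrow\psi(u)>\psi(v)$. Write $D=(v_0,\dots,v_n)$ with $\psi(v_i)=i$, $\mathcal{A}_==\{\psi(v):h(v)=h(v_n)\}$ and $\mathcal{A}_<=\{\psi(v):h(v)<h(v_n)\}$. Expansion rules: (Branching) write $\mathrm{child}_\psi(v_n)=a_0\cdots a_m$; choose $a\in\mathcal{A}_<$ with $a\le a_m$ (any $a\in\mathcal{A}_<$ if the word is empty) and add one arc from $v_n$ to $\psi^{ -1}(a)$. (Elongation) add a new vertex $v_{n+1}$ with exactly one arc, to $\psi^{ -1}(a)$ for some $a\in\mathcal{A}_=$. (Widening) add a new vertex $v_{n+1}$ whose children word is a minimal word of $\mathcal{L}_<(\overline{w})$, where $\overline{w}=\mathrm{child}_\psi(v_n)$, $\mathcal{L}_<(\overline{w})$ is the set of decreasing words $w$ over $\mathcal{A}_<$ with $w>_{\mathrm{lex}}\overline{w}$, and $w$ is minimal if $w\in\mathcal{L}_<(\overline{w})$ but $SC(w)\notin\mathcal{L}_<(\overline{w})$ (i.e. for each letter $a$ of $w$ one arc from $v_{n+1}$ to $\psi^{ -1}(a)$). -}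

module Defs where

open import Data.Nat as ℕ using (ℕ; zero; suc; _≤_; _≥_; _≤?_; _⊔_)
open import Data.Fin as Fin using (Fin; toℕ; inject₁; fromℕ)
open import Data.List using (List; []; _∷_; map)
open import Data.List.Membership.Propositional using (_∈_)
open import Data.List.Relation.Binary.Pointwise using (Pointwise)
open import Data.List.Relation.Binary.Permutation.Propositional using (_↭_)
open import Data.List.Relation.Binary.Lex.Strict using (Lex-<)
open import Data.List.Relation.Unary.All using (All)
open import Data.List.Relation.Unary.Linked using (Linked)
open import Data.Product using (Σ; ∃; _×_)
open import Data.Sum using (_⊎_)
open import Data.Unit using (⊤)
open import Function.Definitions using (Bijective)
open import Relation.Binary.PropositionalEquality using (_≡_; _≢_)
open import Relation.Binary.Construct.Closure.Transitive using (TransClosure)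
open import Relation.Binary.Construct.Closure.ReflexiveTransitive using (Star)
open import Relation.Nullary using (¬_; yes; no)

-- Finite directed multigraphs on the vertex set Fin m.
-- G v is the list of heads of the arcs leaving v, with multiplicity
-- (the multiset child(v); the order of the list is irrelevant).

Graph : ℕ → Set
Graph m = Fin m → List (Fin m)

module _ {m : ℕ} (G : Graph m) where

  Arc : Fin m → Fin m → Set
  Arc u v = v ∈ G u

  Path⁺ : Fin m → Fin m → Set
  Path⁺ = TransClosure Arc

  Acyclic : Set
  Acyclic = ∀ v → ¬ Path⁺ v v

  Connected : Set
  Connected = ∀ u v → Star (λ x y → Arc x y ⊎ Arc y x) u v

  DistinctChildren : Set
  DistinctChildren = ∀ u v → G u ↭ G v → u ≡ v

  -- FDAG: finite connected directed acyclic multigraph whose distinct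
  -- vertices have distinct multisets of children (m ≥ 1 is imposed
  -- separately by the index suc n where used).
  IsFDAG : Set
  IsFDAG = Acyclic × Connected × DistinctChildren

maxList : List ℕ → ℕ
maxList []       = 0
maxList (x ∷ xs) = x ⊔ maxList xs

data HeightIs {m : ℕ} (G : Graph m) : Fin m → ℕ → Set where
  leaf : ∀ {v} → G v ≡ [] → HeightIs G v 0
  node : ∀ {v} (hs : List ℕ) → G v ≢ [] →
         Pointwise (HeightIs G) (G v) hs → HeightIs G v (suc (maxList hs))

insertDesc : ℕ → List ℕ → List ℕ
insertDesc x []       = x ∷ []
insertDesc x (y ∷ ys) with y ≤? x
... | yes _ = x ∷ y ∷ ys
... | no  _ = y ∷ insertDesc x ys

sortDesc : List ℕ → List ℕ
sortDesc []       = []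
sortDesc (x ∷ xs) = insertDesc x (sortDesc xs)

-- strict lexicographic order (proper prefix is smaller)
_<lex_ : List ℕ → List ℕ → Set
_<lex_ = Lex-< _≡_ ℕ._<_

Decreasing : List ℕ → Set
Decreasing = Linked _≥_

SC : {A : Set} → List A → List A
SC []           = []
SC (x ∷ [])     = []
SC (x ∷ y ∷ ys) = x ∷ SC (y ∷ ys)

childψ : {m : ℕ} → Graph m → (Fin m → Fin m) → Fin m → List ℕ
childψ G ψ v = sortDesc (map (λ w → toℕ (ψ w)) (G v))

record IsCanonicalOrdering {m : ℕ} (G : Graph m) (ψ : Fin m → Fin m) : Set where
  field
    bijective : Bijective _≡_ _≡_ ψ
    arcs      : ∀ u v → Arc G u v → ψ v Fin.< ψ u
    heights   : ∀ u v hu hv → HeightIs G u hu → HeightIs G v hv →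
                hv ℕ.< hu → ψ v Fin.< ψ u
    lexico    : ∀ u v h → HeightIs G u h → HeightIs G v h →
                childψ G ψ v <lex childψ G ψ u → ψ v Fin.< ψ u

-- Expansion rules.  D : Graph (suc n) with vertices numbered by its
-- canonical ordering, i.e. vertex i is v_i (ψ = id); v_n = fromℕ n.

BelowLast : ℕ → List ℕ → Set
BelowLast a []           = ⊤
BelowLast a (x ∷ [])     = a ≤ x
BelowLast a (x ∷ y ∷ ys) = BelowLast a (y ∷ ys)

addArc : ∀ {n} → Graph (suc n) → Fin (suc n) → Graph (suc n)
addArc {n} G a v with v Fin.≟ fromℕ n
... | yes _ = a ∷ G v
... | no  _ = G v

snoc : ∀ {k} {A : Set} → (Fin k → A) → A → Fin (suc k) → A
snoc {zero}  f x Fin.zero    = x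
snoc {suc k} f x Fin.zero    = f Fin.zero
snoc {suc k} f x (Fin.suc i) = snoc (λ j → f (Fin.suc j)) x i

addVertex : ∀ {n} → Graph (suc n) → List (Fin (suc n)) → Graph (suc (suc n))
addVertex G w = snoc (λ i → map inject₁ (G i)) (map inject₁ w)

module _ {n : ℕ} (D : Graph (suc n)) (hn : ℕ) where
  -- with hn = h(v_n):
  -- ψ(v) ∈ 𝒜_=
  InEq : Fin (suc n) → Set
  InEq a = HeightIs D a hn
  InLt : Fin (suc n) → Set
  InLt a = ∃ λ ha → HeightIs D a ha × ha ℕ.< hn

  InL : List ℕ → List (Fin (suc n)) → Set
  InL w̄ w = Decreasing (map toℕ w) × All InLt w × (w̄ <lex map toℕ w)

  Minimal : List ℕ → List (Fin (suc n)) → Set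
  Minimal w̄ w = InL w̄ w × ¬ InL w̄ (SC w)

-- One application of a rule turns D into D′ (vertex numbers kept;
-- the new vertex, if any, is fromℕ (suc n), i.e. ψ(v_{n+1}) = n+1).
data Expansion {n : ℕ} (D : Graph (suc n)) : {m : ℕ} → Graph m → Set where
  branching  : ∀ hn → HeightIs D (fromℕ n) hn →
               (a : Fin (suc n)) → InLt D hn a →
               BelowLast (toℕ a) (childψ D (λ v → v) (fromℕ n)) →
               Expansion D (addArc D a)
  elongation : ∀ hn → HeightIs D (fromℕ n) hn →
               (a : Fin (suc n)) → InEq D hn a →
               Expansion D (addVertex D (a ∷ []))
  widening   : ∀ hn → HeightIs D (fromℕ n) hn →
               (w : List (Fin (suc n))) →
               Minimal D hn (childψ D (λ v → v) (fromℕ n)) w →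
               Expansion D (addVertex D w)

-- In each expansion rule D′ arises from D by changing the children of one vertex t, namely v_n
-- (branching) or the new last vertex v_{n+1} (elongation, widening), while every vertex before t
-- keeps its children and hence its height and its word child_ψ.  So the three conditions on ψ,
-- and the distinctness of children multisets, only need checking on pairs involving t.  All
-- arcs leave t towards smaller numbers; h(t) is at least every old height, because canonicity
-- makes h(v_n) maximal; and whenever an old vertex v has height h(t), child(t) >lex child(v):
-- for elongation no such v exists since h(t) = h(v_n) + 1, while for branching and widening
-- child(t) >lex child(v_n) ≥lex child(v), again by canonicity.

module Submission where

open import Defs
open import Data.Empty using (⊥-elim)
open import Data.Fin as Fin using (Fin; toℕ; fromℕ; inject₁; lower₁)
open import Data.Fin.Properties
  using (toℕ-fromℕ; toℕ-injective; toℕ-inject₁; toℕ<n; ≤fromℕ; <⇒≢; inject₁-lower₁)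
open import Data.List using (List; []; _∷_; _∷ʳ_; map; foldr)
open import Data.List.Properties
  using (map-id; map-∘; map-cong; map-injective; ∷-injectiveˡ; ∷-injectiveʳ)
open import Data.List.Membership.Propositional using (_∈_)
open import Data.List.Membership.Propositional.Properties using (∈-map⁺; ∈-map⁻)
open import Data.List.Relation.Unary.All as All using (All; []; _∷_)
open import Data.List.Relation.Unary.Any using (here; there)
open import Data.List.Relation.Unary.Linked using ([-]; _∷_)
open import Data.List.Relation.Unary.Sorted.TotalOrder.Properties using (↗↭↗⇒≋)
open import Data.List.Relation.Binary.Pointwise as Pointwise
  using (Pointwise; []; _∷_; Pointwise-≡⇒≡)
open import Data.List.Relation.Binary.Lex.Strict
  using (halt; this; next; xs≮[]; <-irreflexive; <-transitive; <-compare)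
import Data.List.Relation.Binary.Permutation.Propositional as ↭
open ↭ using (_↭_; ↭-refl; ↭-sym; ↭-trans; ↭-prep; ↭⇒↭ₛ)
open import Data.List.Relation.Binary.Permutation.Propositional.Properties
  using (↭-empty-inv; ∈-resp-↭; ∷↭∷ʳ; ↭-map-inv) renaming (map⁺ to ↭-map⁺)
open import Data.Nat using (ℕ; zero; suc; z≤n; s≤s; _≤_; _<_; _⊔_; _≤?_; s≤s⁻¹)
open import Data.Nat.Properties
  using ( ≤-decTotalOrder; ≤-totalOrder; ≤-refl; ≤-reflexive; ≤-antisym; ≤-trans; n≤1+n
        ; <-irrefl; <-trans; <-cmp; <-resp₂-≡; ≮⇒≥; <⇒≱; <⇒≤
        ; m≤m⊔n; ⊔-lub; ⊔-sel; m≤n⇒m⊔n≡n; ⊔-identityʳ; m≤n⇒m<n∨m≡n; ⊔-0-isCommutativeMonoid)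
open import Data.Product using (∃; _×_; _,_; -,_)
open import Data.Sum as Sum using (_⊎_; inj₁; inj₂)
open import Function using (id; _∘_)
open import Function.Construct.Identity using () renaming (bijective to id-bijective)
open import Relation.Binary.Construct.Closure.ReflexiveTransitive as Star using (ε; _◅_; _◅◅_)
open import Relation.Binary.Construct.Closure.Transitive using ([_]; _∷_)
open import Relation.Binary.Definitions using (tri<; tri≈; tri>)
open import Relation.Binary.PropositionalEquality
  using ( _≡_; _≢_; refl; sym; trans; cong; cong₂; subst; subst₂; isEquivalence; setoid
        ; module ≡-Reasoning)
open import Relation.Nullary using (¬_; yes; no)
open import Relation.Nullary.Decidable using (dec-true; dec-false)
import Relation.Binary.Construct.Flip.EqAndOrd as Flip

open import Data.List.Relation.Binary.Permutation.Setoid.Properties (setoid ℕ)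
  using (foldr-commMonoid)
open import Data.List.Sort.InsertionSort.Base (Flip.decTotalOrder ≤-decTotalOrder)
  using (insert; sort)
open import Data.List.Sort.InsertionSort.Properties (Flip.decTotalOrder ≤-decTotalOrder)
  using (sort-↭; sort-↗)

private
  variable
    k m n a h h₁ h₂ hn H x y : ℕ
    xs ys w w₁ w₂ w₃ hs hs′ : List ℕ
    A : Set
    R : A → ℕ → Set

insertDesc≡insert : ∀ x ys → insertDesc x ys ≡ insert x ys
insertDesc≡insert x []       = refl
insertDesc≡insert x (y ∷ ys) with y ≤? x
... | yes y≤x rewrite dec-true  (y ≤? x) y≤x = refl
... | no  y≰x rewrite dec-false (y ≤? x) y≰x = cong (y ∷_) (insertDesc≡insert x ys)

sortDesc≡sort : ∀ xs → sortDesc xs ≡ sort xs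
sortDesc≡sort []       = refl
sortDesc≡sort (x ∷ xs) rewrite sortDesc≡sort xs = insertDesc≡insert x (sort xs)

sortDesc-↭ : ∀ xs → sortDesc xs ↭ xs
sortDesc-↭ xs rewrite sortDesc≡sort xs = sort-↭ xs

sortDesc-decreasing : ∀ xs → Decreasing (sortDesc xs)
sortDesc-decreasing xs rewrite sortDesc≡sort xs = sort-↗ xs

decreasing-↭⇒≡ : Decreasing xs → Decreasing ys → xs ↭ ys → xs ≡ ys
decreasing-↭⇒≡ dxs dys p =
  Pointwise-≡⇒≡ (↗↭↗⇒≋ (Flip.totalOrder ≤-totalOrder) dxs dys (↭⇒↭ₛ p))

sortDesc-unique : Decreasing ys → xs ↭ ys → sortDesc xs ≡ ys
sortDesc-unique {xs = xs} dys p =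
  decreasing-↭⇒≡ (sortDesc-decreasing xs) dys (↭-trans (sortDesc-↭ xs) p)

sortDesc-cong-↭ : xs ↭ ys → sortDesc xs ≡ sortDesc ys
sortDesc-cong-↭ {ys = ys} p =
  sortDesc-unique (sortDesc-decreasing ys) (↭-trans p (↭-sym (sortDesc-↭ ys)))

∷ʳ-decreasing : Decreasing w → BelowLast a w → Decreasing (w ∷ʳ a)
∷ʳ-decreasing {[]}          _          _   = [-]
∷ʳ-decreasing {x ∷ []}      _          a≤x = a≤x ∷ [-]
∷ʳ-decreasing {x ∷ y ∷ w}   (x≥y ∷ dw) b   = x≥y ∷ ∷ʳ-decreasing dw b

sortDesc-∷-belowLast : BelowLast a (sortDesc xs) → sortDesc (a ∷ xs) ≡ sortDesc xs ∷ʳ a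
sortDesc-∷-belowLast {a} {xs} b =
  sortDesc-unique (∷ʳ-decreasing (sortDesc-decreasing xs) b)
    (↭-trans (↭-prep a (↭-sym (sortDesc-↭ xs))) (∷↭∷ʳ a (sortDesc xs)))

<lex-irrefl : ¬ w <lex w
<lex-irrefl = <-irreflexive <-irrefl (Pointwise.refl refl)

<lex-trans : w₁ <lex w₂ → w₂ <lex w₃ → w₁ <lex w₃
<lex-trans = <-transitive isEquivalence <-resp₂-≡ <-trans

<lex-∷ʳ : ∀ w a → w <lex (w ∷ʳ a)
<lex-∷ʳ []      a = halt
<lex-∷ʳ (x ∷ w) a = next refl (<lex-∷ʳ w a)

≮lex-<lex-trans : ¬ w₂ <lex w₁ → w₂ <lex w₃ → w₁ <lex w₃
≮lex-<lex-trans {w₂} {w₁} w₂≮w₁ w₂<w₃ with <-compare sym <-cmp w₁ w₂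
... | tri< w₁<w₂ _ _     = <lex-trans w₁<w₂ w₂<w₃
... | tri≈ _ w₁≋w₂ _     = subst (_<lex _) (sym (Pointwise-≡⇒≡ w₁≋w₂)) w₂<w₃
... | tri> _ _ w₂<w₁     = ⊥-elim (w₂≮w₁ w₂<w₁)

∈-decreasing⇒≤-head : Decreasing (y ∷ ys) → x ∈ (y ∷ ys) → x ≤ y
∈-decreasing⇒≤-head _          (here refl) = ≤-refl
∈-decreasing⇒≤-head (y≥z ∷ dw) (there x∈) = ≤-trans (∈-decreasing⇒≤-head dw x∈) y≥z

∈-<lex⇒≤-head : Decreasing w → x ∈ w → w <lex (y ∷ ys) → x ≤ y
∈-<lex⇒≤-head {_ ∷ _} dw x∈ (this z<y) =
  ≤-trans (∈-decreasing⇒≤-head dw x∈) (<⇒≤ z<y)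
∈-<lex⇒≤-head {_ ∷ _} dw x∈ (next refl _) = ∈-decreasing⇒≤-head dw x∈

maxList≡foldr : ∀ hs → maxList hs ≡ foldr _⊔_ 0 hs
maxList≡foldr []       = refl
maxList≡foldr (h ∷ hs) = cong (h ⊔_) (maxList≡foldr hs)

maxList-↭ : hs ↭ hs′ → maxList hs ≡ maxList hs′
maxList-↭ {hs} {hs′} p = begin
  maxList hs       ≡⟨ maxList≡foldr hs ⟩
  foldr _⊔_ 0 hs   ≡⟨ foldr-commMonoid ⊔-0-isCommutativeMonoid (↭⇒↭ₛ p) ⟩
  foldr _⊔_ 0 hs′  ≡⟨ maxList≡foldr hs′ ⟨
  maxList hs′      ∎
  where open ≡-Reasoning

maxList-lub : All (_≤ k) hs → maxList hs ≤ k
maxList-lub []         = z≤n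
maxList-lub (h≤k ∷ ps) = ⊔-lub h≤k (maxList-lub ps)

maxList-attained : ∀ {as : List A} → as ≢ [] → Pointwise R as hs →
                   ∃ λ x → x ∈ as × R x (maxList hs)
maxList-attained as≢[] [] = ⊥-elim (as≢[] refl)
maxList-attained {R = R} _ (_∷_ {x = x} {y = h} r []) =
  x , here refl , subst (R x) (sym (⊔-identityʳ h)) r
maxList-attained {R = R} _ (_∷_ {x = x} {y = h} {ys = hs} r pw@(_ ∷ _))
  with ⊔-sel h (maxList hs) | maxList-attained (λ ()) pw
... | inj₁ h⊔M≡h | _            = x , here refl , subst (R x) (sym h⊔M≡h) r
... | inj₂ h⊔M≡M | y , y∈ , ry = y , there y∈ , subst (R y) (sym h⊔M≡M) ry

Pointwise-↭ : ∀ {as bs : List A} → as ↭ bs → Pointwise R as hs →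
              ∃ λ hs′ → hs ↭ hs′ × Pointwise R bs hs′
Pointwise-↭ ↭.refl pw = -, ↭-refl , pw
Pointwise-↭ (↭.prep _ p) (r ∷ pw) with Pointwise-↭ p pw
... | _ , q , pw′ = -, ↭-prep _ q , r ∷ pw′
Pointwise-↭ (↭.swap _ _ p) (r₁ ∷ r₂ ∷ pw) with Pointwise-↭ p pw
... | _ , q , pw′ = -, ↭.swap _ _ q , r₂ ∷ r₁ ∷ pw′
Pointwise-↭ (↭.trans p q) pw with Pointwise-↭ p pw
... | _ , q₁ , pw₁ with Pointwise-↭ q pw₁
...   | _ , q₂ , pw₂ = -, ↭-trans q₁ q₂ , pw₂

map≡[]⇒≡[] : ∀ {B : Set} {f : A → B} {as} → map f as ≡ [] → as ≡ []
map≡[]⇒≡[] {as = []} _ = refl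

module _ {G : Graph m} where

  mutual
    height-functional : ∀ {v} → HeightIs G v h₁ → HeightIs G v h₂ → h₁ ≡ h₂
    height-functional (leaf _)       (leaf _)       = refl
    height-functional (leaf e)       (node _ ne _)  = ⊥-elim (ne e)
    height-functional (node _ ne _)  (leaf e)       = ⊥-elim (ne e)
    height-functional (node _ _ pw₁) (node _ _ pw₂) =
      cong (suc ∘ maxList) (heights-functional pw₁ pw₂)

    heights-functional : ∀ {vs} → Pointwise (HeightIs G) vs hs → Pointwise (HeightIs G) vs hs′ →
                         hs ≡ hs′
    heights-functional []         []         = refl
    heights-functional (r₁ ∷ pw₁) (r₂ ∷ pw₂) =
      cong₂ _∷_ (height-functional r₁ r₂) (heights-functional pw₁ pw₂)

  height-↭ : ∀ {u v} → G u ↭ G v → HeightIs G u h → HeightIs G v h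
  height-↭ {v = v} p (leaf e) = leaf (↭-empty-inv (↭-sym (subst (_↭ G v) e p)))
  height-↭ {u = u} p (node hs ne pw) with Pointwise-↭ p pw
  ... | hs′ , q , pw′ =
    subst (HeightIs G _) (cong suc (sym (maxList-↭ q)))
      (node hs′ (λ e → ne (↭-empty-inv (subst (G u ↭_) e p))) pw′)

module HeightEmbedding {G : Graph k} {G′ : Graph m} (f : Fin k → Fin m)
  (Old : Fin k → Set) (old-closed : ∀ {i j} → j ∈ G i → Old i → Old j)
  (children-embed : ∀ {i} → Old i → G′ (f i) ≡ map f (G i)) where

  children-old : ∀ {i} → Old i → All Old (G i)
  children-old o = All.tabulate (λ j∈ → old-closed j∈ o)

  mutual
    height-embed : ∀ {i} → Old i → HeightIs G i h → HeightIs G′ (f i) h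
    height-embed o (leaf e) = leaf (trans (children-embed o) (cong (map f) e))
    height-embed o (node hs ne pw) =
      node hs (ne ∘ map≡[]⇒≡[] ∘ trans (sym (children-embed o)))
        (subst (λ l → Pointwise (HeightIs G′) l hs) (sym (children-embed o))
          (heights-embed (children-old o) pw))

    heights-embed : ∀ {is} → All Old is → Pointwise (HeightIs G) is hs →
                    Pointwise (HeightIs G′) (map f is) hs
    heights-embed []       []       = []
    heights-embed (o ∷ os) (r ∷ pw) = height-embed o r ∷ heights-embed os pw

  -- The index equation x ≡ f i keeps the recursion structural.
  mutual
    height-unembed : ∀ {x i} → HeightIs G′ x h → x ≡ f i → Old i → HeightIs G i h
    height-unembed (leaf e) refl o = leaf (map≡[]⇒≡[] (trans (sym (children-embed o)) e))
    height-unembed (node hs ne pw) refl o =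
      node hs (ne ∘ trans (children-embed o) ∘ cong (map f))
        (heights-unembed pw (children-embed o) (children-old o))

    heights-unembed : ∀ {ys is} → Pointwise (HeightIs G′) ys hs → ys ≡ map f is → All Old is →
                      Pointwise (HeightIs G) is hs
    heights-unembed {is = []}    []       _  _        = []
    heights-unembed {is = _ ∷ _} []       () _
    heights-unembed {is = []}    (_ ∷ _)  () _
    heights-unembed {is = _ ∷ _} (r ∷ pw) e  (o ∷ os) =
      height-unembed r (∷-injectiveˡ e) o ∷ heights-unembed pw (∷-injectiveʳ e) os

  height-of-embedded-children : ∀ {v i is} → G′ v ≡ map f (i ∷ is) → All Old (i ∷ is) →
                                Pointwise (HeightIs G) (i ∷ is) hs →
                                HeightIs G′ v (suc (maxList hs))
  height-of-embedded-children {hs = hs} e os pw =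
    node hs (λ e′ → f∷≢[] (trans (sym e) e′))
      (subst (λ l → Pointwise (HeightIs G′) l hs) (sym e) (heights-embed os pw))
    where
    f∷≢[] : ∀ {j js} → map f (j ∷ js) ≢ []
    f∷≢[] ()

descending⇒acyclic : {G : Graph m} → (∀ {u v} → Arc G u v → toℕ v < toℕ u) → Acyclic G
descending⇒acyclic {G = G} desc v p = <-irrefl refl (path-descends p)
  where
  path-descends : ∀ {u w} → Path⁺ G u w → toℕ w < toℕ u
  path-descends [ uw ]   = desc uw
  path-descends (uv ∷ p) = <-trans (path-descends p) (desc uv)

module _ {G : Graph m} (co : IsCanonicalOrdering G id) where
  open IsCanonicalOrdering co

  height-monotone : ∀ {u v hu hv} → toℕ u ≤ toℕ v → HeightIs G u hu → HeightIs G v hv → hu ≤ hv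
  height-monotone u≤v du dv = ≮⇒≥ λ hv<hu → <⇒≱ (heights _ _ _ _ du dv hv<hu) u≤v

  childψ-monotone : ∀ {u v} → toℕ u ≤ toℕ v → HeightIs G u h → HeightIs G v h →
                    ¬ childψ G id v <lex childψ G id u
  childψ-monotone u≤v du dv v<u = <⇒≱ (lexico _ _ _ du dv v<u) u≤v

module _ {D : Graph (suc n)} (co : IsCanonicalOrdering D id) (dn : HeightIs D (fromℕ n) hn) where

  last-height-maximal : ∀ {i} → HeightIs D i h → h ≤ hn
  last-height-maximal di = height-monotone co (≤fromℕ _) di dn

  last-word-maximal : ∀ {i} → HeightIs D i hn → childψ D id (fromℕ n) <lex w → childψ D id i <lex w
  last-word-maximal di = ≮lex-<lex-trans (childψ-monotone co (≤fromℕ _) di dn)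

record TopExtension (D : Graph (suc n)) (D′ : Graph m) : Set where
  field
    embed             : Fin (suc n) → Fin m
    top               : Fin m
    toℕ-embed         : ∀ i → toℕ (embed i) ≡ toℕ i
    covers            : ∀ x → x ≡ top ⊎ ∃ λ i → toℕ i < toℕ top × x ≡ embed i
    children-embed    : ∀ {i} → toℕ i < toℕ top → D′ (embed i) ≡ map embed (D i)
    topChildren       : List (Fin (suc n))
    children-top      : D′ top ≡ map embed topChildren
    topChildren-below : All (λ i → toℕ i < toℕ top) topChildren

  Below : Fin (suc n) → Set
  Below i = toℕ i < toℕ top

  topWord : List ℕ
  topWord = sortDesc (map toℕ topChildren)

module TopExtensionProperties {D : Graph (suc n)} {D′ : Graph m}
  (co : IsCanonicalOrdering D id) (E : TopExtension D D′) where
  open IsCanonicalOrdering co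
  open TopExtension E public

  below-closed : ∀ {i j} → j ∈ D i → Below i → Below j
  below-closed j∈ i<t = <-trans (arcs _ _ j∈) i<t

  open HeightEmbedding {G = D} {G′ = D′} embed Below below-closed children-embed public

  embed-injective : ∀ {i j} → embed i ≡ embed j → i ≡ j
  embed-injective {i} {j} e =
    toℕ-injective (trans (sym (toℕ-embed i)) (trans (cong toℕ e) (toℕ-embed j)))

  embed-below : ∀ {i} → Below i → toℕ (embed i) < toℕ top
  embed-below {i} = subst (_< toℕ top) (sym (toℕ-embed i))

  embed-< : ∀ {i j} → toℕ j < toℕ i → toℕ (embed j) < toℕ (embed i)
  embed-< {i} {j} = subst₂ _<_ (sym (toℕ-embed j)) (sym (toℕ-embed i))

  ↭-unembed : ∀ {is js} → map embed is ↭ map embed js → is ↭ js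
  ↭-unembed p with ↭-map-inv embed p
  ... | _ , e , q = subst (_ ↭_) (sym (map-injective embed-injective e)) q

  childψ-of-embedded : ∀ {x is} → D′ x ≡ map embed is → childψ D′ id x ≡ sortDesc (map toℕ is)
  childψ-of-embedded {is = is} e rewrite e =
    cong sortDesc (trans (sym (map-∘ is)) (map-cong toℕ-embed is))

  childψ-embed : ∀ {i} → Below i → childψ D′ id (embed i) ≡ childψ D id i
  childψ-embed o = childψ-of-embedded (children-embed o)

  childψ-top : childψ D′ id top ≡ topWord
  childψ-top = childψ-of-embedded children-top

  arcs-descend : ∀ {u v} → Arc D′ u v → toℕ v < toℕ u
  arcs-descend {u} {v} uv with covers u
  ... | inj₁ refl with ∈-map⁻ embed (subst (v ∈_) children-top uv)
  ...   | j , j∈ , refl = embed-below (All.lookup topChildren-below j∈)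
  arcs-descend {u} {v} uv | inj₂ (i , o , refl)
    with ∈-map⁻ embed (subst (v ∈_) (children-embed o) uv)
  ...   | j , j∈ , refl = embed-< (arcs _ _ j∈)

module TopExtensionCanonical {D : Graph (suc n)} {D′ : Graph m}
  (distinct : DistinctChildren D) (co : IsCanonicalOrdering D id) (E : TopExtension D D′)
  (top-height : HeightIs D′ (TopExtension.top E) H)
  (heights-≤ : ∀ {i h} → HeightIs D i h → h ≤ H)
  (topWord-max : ∀ {i} → TopExtension.Below E i → HeightIs D i H →
                 childψ D id i <lex TopExtension.topWord E)
  where
  open IsCanonicalOrdering co
  open TopExtensionProperties co E

  unembed : ∀ {i} → HeightIs D′ (embed i) h → Below i → HeightIs D i h
  unembed d = height-unembed d refl

  top-not-twin : ∀ {j} → Below j → ¬ (D′ top ↭ D′ (embed j))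
  top-not-twin {j} o p = <lex-irrefl (subst (childψ D id j <lex_) same-word (topWord-max o dj))
    where
    dj : HeightIs D j H
    dj = unembed (height-↭ p top-height) o
    same-word : topWord ≡ childψ D id j
    same-word = begin
      topWord                   ≡⟨ childψ-top ⟨
      childψ D′ id top          ≡⟨ sortDesc-cong-↭ (↭-map⁺ toℕ p) ⟩
      childψ D′ id (embed j)    ≡⟨ childψ-embed o ⟩
      childψ D id j             ∎
      where open ≡-Reasoning

  distinct′ : DistinctChildren D′
  distinct′ u v p with covers u | covers v
  ... | inj₁ refl           | inj₁ refl            = refl
  ... | inj₁ refl           | inj₂ (j , o , refl)  = ⊥-elim (top-not-twin o p)
  ... | inj₂ (i , o , refl) | inj₁ refl            = ⊥-elim (top-not-twin o (↭-sym p))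
  ... | inj₂ (i , o , refl) | inj₂ (j , o′ , refl) =
    cong embed (distinct i j (↭-unembed (subst₂ _↭_ (children-embed o) (children-embed o′) p)))

  heights′ : ∀ u v hu hv → HeightIs D′ u hu → HeightIs D′ v hv → hv < hu → toℕ v < toℕ u
  heights′ u v hu hv du dv hv<hu with covers u | covers v
  ... | inj₁ refl           | inj₁ refl            = ⊥-elim (<-irrefl (height-functional dv du) hv<hu)
  ... | inj₁ refl           | inj₂ (j , o , refl)  = embed-below o
  ... | inj₂ (i , o , refl) | inj₁ refl            =
    ⊥-elim (<⇒≱ hv<hu (subst (hu ≤_) (height-functional top-height dv) (heights-≤ (unembed du o))))
  ... | inj₂ (i , o , refl) | inj₂ (j , o′ , refl) =
    embed-< (heights i j hu hv (unembed du o) (unembed dv o′) hv<hu)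

  lexico′ : ∀ u v h → HeightIs D′ u h → HeightIs D′ v h →
            childψ D′ id v <lex childψ D′ id u → toℕ v < toℕ u
  lexico′ u v h du dv lt with covers u | covers v
  ... | inj₁ refl           | inj₁ refl            = ⊥-elim (<lex-irrefl lt)
  ... | inj₁ refl           | inj₂ (j , o , refl)  = embed-below o
  ... | inj₂ (i , o , refl) | inj₁ refl            =
    ⊥-elim (<lex-irrefl (<lex-trans (topWord-max o di)
                                    (subst₂ _<lex_ childψ-top (childψ-embed o) lt)))
    where
    di : HeightIs D i H
    di = subst (HeightIs D i) (height-functional dv top-height) (unembed du o)
  ... | inj₂ (i , o , refl) | inj₂ (j , o′ , refl) =
    embed-< (lexico i j h (unembed du o) (unembed dv o′)
              (subst₂ _<lex_ (childψ-embed o′) (childψ-embed o) lt))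

  canonical′ : IsCanonicalOrdering D′ id
  canonical′ = record
    { bijective = id-bijective _≡_
    ; arcs      = λ _ _ → arcs-descend
    ; heights   = heights′
    ; lexico    = lexico′
    }

topExtension-canonical :
  ∀ {D : Graph (suc n)} {D′ : Graph m} → IsFDAG D → IsCanonicalOrdering D id →
  (E : TopExtension D D′) → Connected D′ →
  HeightIs D′ (TopExtension.top E) H → (∀ {i h} → HeightIs D i h → h ≤ H) →
  (∀ {i} → TopExtension.Below E i → HeightIs D i H → childψ D id i <lex TopExtension.topWord E) →
  IsFDAG D′ × IsCanonicalOrdering D′ id
topExtension-canonical (_ , _ , distinct) co E conn top-height heights-≤ topWord-max =
  (descending⇒acyclic arcs-descend , conn , distinct′) , canonical′
  where
  open TopExtensionCanonical distinct co E top-height heights-≤ topWord-max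
  open TopExtensionProperties co E using (arcs-descend)

fromℕ-or-< : (x : Fin (suc k)) → x ≡ fromℕ k ⊎ toℕ x < toℕ (fromℕ k)
fromℕ-or-< x with m≤n⇒m<n∨m≡n (≤fromℕ x)
... | inj₁ x<k = inj₂ x<k
... | inj₂ x≡k = inj₁ (toℕ-injective x≡k)

fromℕ-or-inject₁ : (x : Fin (suc k)) → x ≡ fromℕ k ⊎ ∃ λ i → x ≡ inject₁ i
fromℕ-or-inject₁ {k} x = Sum.map₂ (λ x<k → -, sym (inject₁-lower₁ x (k≢x x<k))) (fromℕ-or-< x)
  where
  k≢x : toℕ x < toℕ (fromℕ k) → k ≢ toℕ x
  k≢x x<k k≡x = <-irrefl (trans (sym k≡x) (sym (toℕ-fromℕ k))) x<k

<fromℕ-suc : ∀ (i : Fin (suc n)) → toℕ i < toℕ (fromℕ (suc n))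
<fromℕ-suc {n} i = subst (toℕ i <_) (sym (toℕ-fromℕ (suc n))) (toℕ<n i)

snoc-inject₁ : ∀ (f : Fin k → A) x i → snoc f x (inject₁ i) ≡ f i
snoc-inject₁ {suc k} f x Fin.zero    = refl
snoc-inject₁ {suc k} f x (Fin.suc i) = snoc-inject₁ (f ∘ Fin.suc) x i

snoc-fromℕ : ∀ (f : Fin k → A) x → snoc f x (fromℕ k) ≡ x
snoc-fromℕ {zero}  f x = refl
snoc-fromℕ {suc k} f x = snoc-fromℕ (f ∘ Fin.suc) x

module _ (D : Graph (suc n)) (a : Fin (suc n)) where

  addArc-last : addArc D a (fromℕ n) ≡ a ∷ D (fromℕ n)
  addArc-last with fromℕ n Fin.≟ fromℕ n
  ... | yes _  = refl
  ... | no n≢n = ⊥-elim (n≢n refl)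

  addArc-other : ∀ {i} → i ≢ fromℕ n → addArc D a i ≡ D i
  addArc-other {i} i≢n with i Fin.≟ fromℕ n
  ... | yes i≡n = ⊥-elim (i≢n i≡n)
  ... | no _    = refl

  addArc-⊇ : ∀ {x y} → Arc D x y → Arc (addArc D a) x y
  addArc-⊇ {x} xy with x Fin.≟ fromℕ n
  ... | yes _ = there xy
  ... | no _  = xy

  addArc-connected : Connected D → Connected (addArc D a)
  addArc-connected conn u v = Star.map (Sum.map addArc-⊇ addArc-⊇) (conn u v)

  addArc-topExtension : IsCanonicalOrdering D id → toℕ a < toℕ (fromℕ n) →
                        TopExtension D (addArc D a)
  addArc-topExtension co a<n = record
    { embed             = id
    ; top               = fromℕ n
    ; toℕ-embed         = λ _ → refl
    ; covers            = λ x → Sum.map₂ (λ x<n → x , x<n , refl) (fromℕ-or-< x)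
    ; children-embed    = λ i<n → trans (addArc-other (<⇒≢ i<n)) (sym (map-id _))
    ; topChildren       = a ∷ D (fromℕ n)
    ; children-top      = trans addArc-last (sym (map-id _))
    ; topChildren-below = a<n ∷ All.tabulate (λ j∈ → IsCanonicalOrdering.arcs co _ _ j∈)
    }

branching-canonical :
  ∀ {D : Graph (suc n)} {a} → IsFDAG D → IsCanonicalOrdering D id →
  HeightIs D (fromℕ n) hn → InLt D hn a → BelowLast (toℕ a) (childψ D id (fromℕ n)) →
  IsFDAG (addArc D a) × IsCanonicalOrdering (addArc D a) id
branching-canonical {n} {hn} {D} {a} fdag@(_ , conn , _) co dn (ha , da , ha<hn) a-below =
  topExtension-canonical fdag co E (addArc-connected D a conn) (top-height dn ha<hn)
    (last-height-maximal co dn) (λ _ → topWord-max)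
  where
  E = addArc-topExtension D a co (IsCanonicalOrdering.heights co _ _ _ _ dn da ha<hn)
  open TopExtensionProperties co E
    using (height-of-embedded-children; children-top; topChildren-below)

  top-height : HeightIs D (fromℕ n) h → ha < h → HeightIs (addArc D a) (fromℕ n) h
  top-height (leaf _)       ()
  top-height (node hs _ pw) ha<h =
    subst (HeightIs _ _) (cong suc (m≤n⇒m⊔n≡n (s≤s⁻¹ ha<h)))
      (height-of-embedded-children children-top topChildren-below (da ∷ pw))

  w̄ : List ℕ
  w̄ = childψ D id (fromℕ n)

  topWord : List ℕ
  topWord = sortDesc (toℕ a ∷ map toℕ (D (fromℕ n)))

  topWord-max : ∀ {i} → HeightIs D i hn → childψ D id i <lex topWord
  topWord-max di = last-word-maximal co dn di (subst (w̄ <lex_) (sym topWord≡) (<lex-∷ʳ w̄ (toℕ a)))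
    where
    topWord≡ : topWord ≡ w̄ ∷ʳ toℕ a
    topWord≡ = sortDesc-∷-belowLast {xs = map toℕ (D (fromℕ n))} a-below

module _ (D : Graph (suc n)) (w : List (Fin (suc n))) where

  addVertex-old : ∀ i → addVertex D w (inject₁ i) ≡ map inject₁ (D i)
  addVertex-old = snoc-inject₁ (λ i → map inject₁ (D i)) (map inject₁ w)

  addVertex-new : addVertex D w (fromℕ (suc n)) ≡ map inject₁ w
  addVertex-new = snoc-fromℕ (λ i → map inject₁ (D i)) (map inject₁ w)

  addVertex-topExtension : TopExtension D (addVertex D w)
  addVertex-topExtension = record
    { embed             = inject₁
    ; top               = fromℕ (suc n)
    ; toℕ-embed         = toℕ-inject₁
    ; covers            = λ x → Sum.map₂ (λ (i , x≡i) → i , <fromℕ-suc i , x≡i) (fromℕ-or-inject₁ x)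
    ; children-embed    = λ {i} _ → addVertex-old i
    ; topChildren       = w
    ; children-top      = addVertex-new
    ; topChildren-below = All.universal <fromℕ-suc w
    }

  arc-inject₁ : ∀ {x y} → Arc D x y → Arc (addVertex D w) (inject₁ x) (inject₁ y)
  arc-inject₁ {x} xy = subst (_ ∈_) (sym (addVertex-old x)) (∈-map⁺ inject₁ xy)

  arc-new : ∀ {b} → b ∈ w → Arc (addVertex D w) (fromℕ (suc n)) (inject₁ b)
  arc-new b∈w = subst (_ ∈_) (sym addVertex-new) (∈-map⁺ inject₁ b∈w)

  connected-inject₁ : Connected D → ∀ i j →
    Star.Star (λ x y → Arc (addVertex D w) x y ⊎ Arc (addVertex D w) y x) (inject₁ i) (inject₁ j)
  connected-inject₁ conn i j = Star.gmap inject₁ (Sum.map arc-inject₁ arc-inject₁) (conn i j)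

  addVertex-connected : ∀ {b} → Connected D → b ∈ w → Connected (addVertex D w)
  addVertex-connected {b} conn b∈w u v with fromℕ-or-inject₁ u | fromℕ-or-inject₁ v
  ... | inj₁ refl       | inj₁ refl       = ε
  ... | inj₁ refl       | inj₂ (j , refl) = inj₁ (arc-new b∈w) ◅ connected-inject₁ conn b j
  ... | inj₂ (i , refl) | inj₁ refl       = connected-inject₁ conn i b ◅◅ (inj₂ (arc-new b∈w) ◅ ε)
  ... | inj₂ (i , refl) | inj₂ (j , refl) = connected-inject₁ conn i j

addVertex-canonical :
  ∀ {D : Graph (suc n)} {b bs} → IsFDAG D → IsCanonicalOrdering D id →
  HeightIs D (fromℕ n) hn → Pointwise (HeightIs D) (b ∷ bs) hs → hn ≤ suc (maxList hs) →
  (∀ {i} → HeightIs D i (suc (maxList hs)) → childψ D id i <lex sortDesc (map toℕ (b ∷ bs))) →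
  IsFDAG (addVertex D (b ∷ bs)) × IsCanonicalOrdering (addVertex D (b ∷ bs)) id
addVertex-canonical {D = D} {b} {bs} fdag@(_ , conn , _) co dn pw hn≤H topWord-max =
  topExtension-canonical fdag co E (addVertex-connected D (b ∷ bs) conn (here refl))
    (height-of-embedded-children children-top topChildren-below pw)
    (λ di → ≤-trans (last-height-maximal co dn di) hn≤H) (λ _ → topWord-max)
  where
  E = addVertex-topExtension D (b ∷ bs)
  open TopExtensionProperties co E
    using (height-of-embedded-children; children-top; topChildren-below)

elongation-canonical :
  ∀ {D : Graph (suc n)} {a} → IsFDAG D → IsCanonicalOrdering D id →
  HeightIs D (fromℕ n) hn → InEq D hn a →
  IsFDAG (addVertex D (a ∷ [])) × IsCanonicalOrdering (addVertex D (a ∷ [])) id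
elongation-canonical {hn = hn} fdag co dn da =
  addVertex-canonical fdag co dn (da ∷ []) (≤-trans (m≤m⊔n hn 0) (n≤1+n _))
    (λ di → ⊥-elim (<⇒≱ (s≤s (m≤m⊔n hn 0)) (last-height-maximal co dn di)))

All-∃⇒Pointwise : ∀ {P : ℕ → Set} {as : List A} → All (λ x → ∃ λ h → R x h × P h) as →
                  ∃ λ hs → Pointwise R as hs × All P hs
All-∃⇒Pointwise []                  = -, [] , []
All-∃⇒Pointwise ((_ , r , p) ∷ rps) with All-∃⇒Pointwise rps
... | _ , pw , ps = -, r ∷ pw , p ∷ ps

widening-height :
  ∀ {D : Graph (suc n)} {b bs} → IsCanonicalOrdering D id → HeightIs D (fromℕ n) hn →
  Pointwise (HeightIs D) (b ∷ bs) hs → All (_< hn) hs →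
  childψ D id (fromℕ n) <lex map toℕ (b ∷ bs) → suc (maxList hs) ≡ hn
widening-height co (leaf _) (_ ∷ _) (() ∷ _) _
widening-height {n} {D = D} {b} co (node hs₀ ne pw₀) (_∷_ {y = hb} {ys = hs} db pw) hs<hn w̄<w =
  cong suc (≤-antisym (maxList-lub (All.map s≤s⁻¹ hs<hn)) lower)
  where
  lower : maxList hs₀ ≤ hb ⊔ maxList hs
  lower with maxList-attained ne pw₀
  ... | c , c∈ , dc = ≤-trans (height-monotone co c≤b dc db) (m≤m⊔n hb (maxList hs))
    where
    c≤b : toℕ c ≤ toℕ b
    c≤b = ∈-<lex⇒≤-head (sortDesc-decreasing (map toℕ (D (fromℕ n))))
            (∈-resp-↭ (↭-sym (sortDesc-↭ (map toℕ (D (fromℕ n))))) (∈-map⁺ toℕ c∈)) w̄<w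

widening-canonical :
  ∀ {D : Graph (suc n)} {w} → IsFDAG D → IsCanonicalOrdering D id →
  HeightIs D (fromℕ n) hn → InL D hn (childψ D id (fromℕ n)) w →
  IsFDAG (addVertex D w) × IsCanonicalOrdering (addVertex D w) id
widening-canonical {w = []} _ _ _ (_ , _ , w̄<[]) = ⊥-elim (xs≮[] w̄<[])
widening-canonical {n} {D = D} {w = b ∷ bs} fdag co dn (w↘ , below , w̄<w)
  with All-∃⇒Pointwise {R = HeightIs D} below
... | hs , pw , hs<hn = addVertex-canonical fdag co dn pw (≤-reflexive (sym H≡hn)) topWord-max
  where
  H≡hn : suc (maxList hs) ≡ _
  H≡hn = widening-height co dn pw hs<hn w̄<w

  topWord-max : ∀ {i} → HeightIs D i (suc (maxList hs)) →
                childψ D id i <lex sortDesc (map toℕ (b ∷ bs))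
  topWord-max di =
    last-word-maximal co dn (subst (HeightIs D _) H≡hn di)
      (subst (childψ D id (fromℕ n) <lex_) (sym (sortDesc-unique w↘ ↭-refl)) w̄<w)

proposition2p10 : ∀ {n m : ℕ} (D : Graph (suc n)) (D′ : Graph m) →
    IsFDAG D → IsCanonicalOrdering D (λ v → v) →
    Expansion D D′ →
    IsFDAG D′ × IsCanonicalOrdering D′ (λ v → v)
proposition2p10 _ _ fdag co (branching _ dn _ a∈𝒜< a≤last) = branching-canonical fdag co dn a∈𝒜< a≤last
proposition2p10 _ _ fdag co (elongation _ dn _ a∈𝒜₌)       = elongation-canonical fdag co dn a∈𝒜₌
proposition2p10 _ _ fdag co (widening _ dn _ (w∈𝓛 , _))     = widening-canonical fdag co dn w∈𝓛
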